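{- Let $(X,Z,D)$ be a feasible solution of the STT LP for a tree topology $U$ with $n$ nodes $\{1,\dots,n\}$. Then for every subset $S\subseteq\{1,\dots,n\}$, $\sum_{i\in S}D_i\ge|S|-1$.
   Context: For a tree $U$ and distinct nodes $i,j$, $(i\leftrightsquigarrow j)$ denotes the set of nodes strictly between $i$ and $j$ on the $U$-path. The STT LP for $U$ has variables $D_i$ ($i\in U$), $X_{ij}$ ($i\ne j$), $Z_{kij}=Z_{kji}$ ($k\in(i\leftrightsquigarrow j)$), and constraints: $X_{ij}\ge0$, $Z_{kij}\ge0$; for all $i\ne j$: $X_{ij}+X_{ji}+\sum_{k\in(i\leftrightsquigarrow j)}Z_{kij}\ge1$; $Z_{kij}\le X_{ki}$, $Z_{kij}\le X_{kj}$; $D_i\ge\sum_{j\ne i}X_{ji}$.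
   Formalization: The LP variables $D_i$, $X_{ij}$ and $Z_{kij}$ of the feasible solution take rational values rather than real ones. -}

module Defs where

open import Data.Nat using (ℕ)
open import Data.Fin using (Fin; _≟_)
open import Data.Fin.Subset using (Subset; _∈_; ∣_∣)
open import Data.Fin.Subset.Properties using (_∈?_)
open import Data.List using (List; []; _∷_; map; foldr)
open import Data.List.Membership.Propositional renaming (_∈_ to _∈ₗ_)
open import Data.List.Relation.Unary.Unique.Propositional using (Unique)
open import Data.Integer using (+_)
open import Data.Rational using (ℚ; 0ℚ; 1ℚ; _+_; _-_; _≤_; _/_)
open import Data.Product using (Σ; _×_)
open import Relation.Binary.PropositionalEquality using (_≡_; _≢_)
open import Relation.Nullary using (¬_; does)
open import Data.Bool using (if_then_else_)
open import Data.List using (allFin)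

private variable n : ℕ

data Walk (E : Fin n → Fin n → Set) : Fin n → Fin n → Set where
  [_] : (i : Fin n) → Walk E i i
  _∷_ : ∀ {i k j} → E i k → Walk E k j → Walk E i j

vertices : {E : Fin n → Fin n → Set} {i j : Fin n} → Walk E i j → List (Fin n)
vertices [ i ] = i ∷ []
vertices (_∷_ {i = i} e w) = i ∷ vertices w

IsPath : {E : Fin n → Fin n → Set} {i j : Fin n} → Walk E i j → Set
IsPath w = Unique (vertices w)

inner : {E : Fin n → Fin n → Set} {i j : Fin n} → Walk E i j → List (Fin n)
inner [ i ] = []
inner (e ∷ [ _ ]) = []
inner (_∷_ {k = k} e (e' ∷ w)) = k ∷ inner (e' ∷ w)

record IsTree (E : Fin n → Fin n → Set) : Set where
  field
    sym       : ∀ {i j} → E i j → E j i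
    irrefl    : ∀ {i} → ¬ E i i
    connected : ∀ i j → Σ (Walk E i j) IsPath
    uniquePath : ∀ {i j} (w w' : Walk E i j) → IsPath w → IsPath w' → vertices w ≡ vertices w'

Σᶠ : (Fin n → ℚ) → ℚ
Σᶠ {n} f = foldr _+_ 0ℚ (map f (allFin n))

Σ≢ : Fin n → (Fin n → ℚ) → ℚ
Σ≢ i f = Σᶠ (λ j → if does (j ≟ i) then 0ℚ else f j)

Σ∈ : Subset n → (Fin n → ℚ) → ℚ
Σ∈ S f = Σᶠ (λ i → if does (i ∈? S) then f i else 0ℚ)

Σₗ : List (Fin n) → (Fin n → ℚ) → ℚ
Σₗ ks f = foldr _+_ 0ℚ (map f ks)

-- Feasible solution of the STT LP for tree U = (Fin n, E).
-- Z k i j is only meaningful for k strictly between i and j on the U-path.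
record Feasible {E : Fin n → Fin n → Set} (U : IsTree E)
                (D : Fin n → ℚ) (X : Fin n → Fin n → ℚ) (Z : Fin n → Fin n → Fin n → ℚ) : Set where
  field
    X≥0 : ∀ i j → i ≢ j → 0ℚ ≤ X i j
    Zsym : ∀ {i j} (w : Walk E i j) → IsPath w → i ≢ j → ∀ {k} → k ∈ₗ inner w → Z k i j ≡ Z k j i
    Z≥0 : ∀ {i j} (w : Walk E i j) → IsPath w → i ≢ j → ∀ {k} → k ∈ₗ inner w → 0ℚ ≤ Z k i j
    cover : ∀ {i j} (w : Walk E i j) → IsPath w → i ≢ j →
            1ℚ ≤ X i j + X j i + Σₗ (inner w) (λ k → Z k i j)
    Z≤Xi : ∀ {i j} (w : Walk E i j) → IsPath w → i ≢ j → ∀ {k} → k ∈ₗ inner w → Z k i j ≤ X k i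
    Z≤Xj : ∀ {i j} (w : Walk E i j) → IsPath w → i ≢ j → ∀ {k} → k ∈ₗ inner w → Z k i j ≤ X k j
    D≥ : ∀ i → Σ≢ i (λ j → X j i) ≤ D i

fromℕ : ℕ → ℚ
fromℕ m = (+ m) / 1

{-# OPTIONS --safe #-}
-- Fix a root r ∈ S.  For j ∈ S other than r, the covering constraint of the U-path
-- from j to r, together with Z k j r ≤ X k j, gives
--   1 ≤ X j r + (X r j + Σ_{k strictly between} X k j) ≤ X j r + D j,
-- since r and the inner nodes are distinct nodes other than j and X ≥ 0.
-- Summing over j ∈ S ∖ {r}, the terms X j r add up to at most D r, whence
-- |S| - 1 ≤ Σ_{i ∈ S} D i.  For empty S the bound reads -1 ≤ Σ_{i ∈ S} D i, and D ≥ 0.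
module Submission where

open import Defs
open import Algebra.Bundles using (CommutativeMonoid)
open import Data.Bool using (if_then_else_)
open import Data.Empty using (⊥-elim)
open import Data.Fin using (Fin; zero; suc; _≟_; punchIn)
open import Data.Fin.Properties using (punchInᵢ≢i)
open import Data.Fin.Subset using (Subset; ∣_∣; _∈_; inside; outside)
open import Data.Fin.Subset.Properties using (_∈?_; nonempty?; Empty-unique; ∣⊥∣≡0)
import Data.Integer as ℤ
import Data.Integer.Properties as ℤ
open import Data.List using (List; []; _∷_; _∷ʳ_; foldr; tabulate)
open import Data.List.Membership.Propositional renaming (_∈_ to _∈ₗ_)
open import Data.List.Properties using (map-tabulate)
open import Data.List.Relation.Unary.All using (All; []; _∷_)
open import Data.List.Relation.Unary.AllPairs using ([]; _∷_)
open import Data.List.Relation.Unary.Any using (here; there)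
open import Data.List.Relation.Unary.Unique.Propositional using (Unique)
open import Data.Nat using (ℕ; suc)
import Data.Nat.Coprimality as Coprimality
open import Data.Product using (_,_)
open import Data.Vec using ([]; _∷_)
open import Data.Rational using (ℚ; mkℚ; 0ℚ; 1ℚ; _+_; -_; _-_; _≤_; _/_; *≤*)
import Data.Rational.Properties as ℚ
open import Data.Vec.Functional using (removeAt)
open import Function using (_∘_)
open import Relation.Binary.PropositionalEquality
open import Relation.Nullary using (does; yes; no)
open import Relation.Nullary.Decidable using (dec-true; dec-false)

open import Algebra.Properties.CommutativeMonoid.Sum ℚ.+-0-commutativeMonoid
  using (sum; sum-remove; ∑-distrib-+; sum-cong-≗; sum-replicate-zero)
open import Algebra.Properties.CommutativeSemigroup
  (CommutativeMonoid.commutativeSemigroup ℚ.+-0-commutativeMonoid) using (x∙yz≈y∙xz)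
open import Algebra.Properties.AbelianGroup ℚ.+-0-abelianGroup using (xyx⁻¹≈y)

private variable n : ℕ

fromℕ-suc : ∀ m → fromℕ (suc m) ≡ 1ℚ + fromℕ m
fromℕ-suc m = begin
  fromℕ (suc m)                      ≡⟨ cong (λ k → (ℤ.+ 1 ℤ.+ k) / 1) (ℤ.*-identityʳ (ℤ.+ m)) ⟨
  (ℤ.+ 1 ℤ.+ ℤ.+ m ℤ.* ℤ.+ 1) / 1   ≡⟨⟩
  1ℚ + mkℚ (ℤ.+ m) 0 m/1-coprime    ≡⟨ cong (1ℚ +_) (ℚ.normalize-coprime m/1-coprime) ⟨
  1ℚ + fromℕ m                       ∎
  where
  open ≡-Reasoning
  m/1-coprime = Coprimality.sym (Coprimality.1-coprimeTo m)

-- Σ≢ c f and Σ∈ S f unfold to Σᶠ (except c f) and Σᶠ (restrict S f).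
except : Fin n → (Fin n → ℚ) → Fin n → ℚ
except c f j = if does (j ≟ c) then 0ℚ else f j

restrict : Subset n → (Fin n → ℚ) → Fin n → ℚ
restrict S f i = if does (i ∈? S) then f i else 0ℚ

except-≢ : ∀ {c i : Fin n} (f : Fin n → ℚ) → i ≢ c → except c f i ≡ f i
except-≢ {c = c} {i} f i≢c = cong (if_then 0ℚ else f i) (dec-false (i ≟ c) i≢c)

except-nonneg : ∀ {c : Fin n} {f : Fin n → ℚ} → (∀ i → i ≢ c → 0ℚ ≤ f i) → ∀ i → 0ℚ ≤ except c f i
except-nonneg {c = c} f≥0 i with i ≟ c
... | yes _  = ℚ.≤-refl
... | no i≢c = f≥0 i i≢c

except-self : (f : Fin n → ℚ) (c : Fin n) → except c f c ≡ 0ℚ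
except-self f c = cong (if_then 0ℚ else f c) (dec-true (c ≟ c) refl)

restrict-∈ : ∀ {S : Subset n} {i} (f : Fin n → ℚ) → i ∈ S → restrict S f i ≡ f i
restrict-∈ {S = S} {i} f i∈S = cong (if_then f i else 0ℚ) (dec-true (i ∈? S) i∈S)

Σᶠ≡sum : (f : Fin n → ℚ) → Σᶠ f ≡ sum f
Σᶠ≡sum {n} f = trans (cong (foldr _+_ 0ℚ) (map-tabulate (λ i → i) f)) (foldr-tabulate f)
  where
  foldr-tabulate : ∀ {m} (g : Fin m → ℚ) → foldr _+_ 0ℚ (tabulate g) ≡ sum g
  foldr-tabulate {ℕ.zero} g = refl
  foldr-tabulate {suc m}  g = cong (g zero +_) (foldr-tabulate (g ∘ suc))

sum-mono-≤ : {f g : Fin n → ℚ} → (∀ i → f i ≤ g i) → sum f ≤ sum g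
sum-mono-≤ {ℕ.zero} f≤g = ℚ.≤-refl
sum-mono-≤ {suc n}  f≤g = ℚ.+-mono-≤ (f≤g zero) (sum-mono-≤ (f≤g ∘ suc))

Σᶠ-mono-≤ : {f g : Fin n → ℚ} → (∀ i → f i ≤ g i) → Σᶠ f ≤ Σᶠ g
Σᶠ-mono-≤ {f = f} {g} f≤g rewrite Σᶠ≡sum f | Σᶠ≡sum g = sum-mono-≤ f≤g

Σᶠ-nonneg : {f : Fin n → ℚ} → (∀ i → 0ℚ ≤ f i) → 0ℚ ≤ Σᶠ f
Σᶠ-nonneg {n} {f} f≥0 = begin
  0ℚ                   ≡⟨ sum-replicate-zero n ⟨
  sum {n} (λ _ → 0ℚ)  ≤⟨ sum-mono-≤ f≥0 ⟩
  sum f                ≡⟨ Σᶠ≡sum f ⟨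
  Σᶠ f                 ∎
  where open ℚ.≤-Reasoning

Σᶠ-distrib-+ : (f g : Fin n → ℚ) → Σᶠ (λ i → f i + g i) ≡ Σᶠ f + Σᶠ g
Σᶠ-distrib-+ f g rewrite Σᶠ≡sum (λ i → f i + g i) | Σᶠ≡sum f | Σᶠ≡sum g = ∑-distrib-+ f g

Σᶠ-suc : (f : Fin (suc n) → ℚ) → Σᶠ f ≡ f zero + Σᶠ (f ∘ suc)
Σᶠ-suc f rewrite Σᶠ≡sum f | Σᶠ≡sum (f ∘ suc) = refl

Σᶠ-except : (f : Fin n → ℚ) (r : Fin n) → Σᶠ f ≡ f r + Σᶠ (except r f)
Σᶠ-except {suc n} f r rewrite Σᶠ≡sum f | Σᶠ≡sum (except r f) = begin
  sum f                               ≡⟨ sum-remove {i = r} f ⟩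
  f r + sum (removeAt f r)            ≡⟨ cong (f r +_) (sum-cong-≗ removeAt-except) ⟨
  f r + rest                          ≡⟨ cong (f r +_) (ℚ.+-identityˡ rest) ⟨
  f r + (0ℚ + rest)                   ≡⟨ cong (λ z → f r + (z + rest)) (except-self f r) ⟨
  f r + (except r f r + rest)         ≡⟨ cong (f r +_) (sum-remove {i = r} (except r f)) ⟨
  f r + sum (except r f)              ∎
  where
  open ≡-Reasoning
  rest = sum (removeAt (except r f) r)
  removeAt-except : ∀ k → except r f (punchIn r k) ≡ f (punchIn r k)
  removeAt-except k = except-≢ f (punchInᵢ≢i r k)

Σ∈-remove : ∀ {S : Subset n} {r} (f : Fin n → ℚ) → r ∈ S → Σ∈ S f ≡ f r + Σᶠ (except r (restrict S f))
Σ∈-remove {S = S} {r} f r∈S =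
  trans (Σᶠ-except (restrict S f) r) (cong (_+ Σᶠ (except r (restrict S f))) (restrict-∈ f r∈S))

Σ∈-nonneg : ∀ {S : Subset n} {f} → (∀ i → 0ℚ ≤ f i) → 0ℚ ≤ Σ∈ S f
Σ∈-nonneg {S = S} {f} f≥0 = Σᶠ-nonneg restrict-nonneg
  where
  restrict-nonneg : ∀ i → 0ℚ ≤ restrict S f i
  restrict-nonneg i with i ∈? S
  ... | yes _ = f≥0 i
  ... | no _  = ℚ.≤-refl

fromℕ∣S∣≡Σ∈S1 : (S : Subset n) → fromℕ ∣ S ∣ ≡ Σ∈ S (λ _ → 1ℚ)
fromℕ∣S∣≡Σ∈S1 []            = refl
fromℕ∣S∣≡Σ∈S1 (inside ∷ S)  = begin
  fromℕ (suc ∣ S ∣)          ≡⟨ fromℕ-suc ∣ S ∣ ⟩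
  1ℚ + fromℕ ∣ S ∣           ≡⟨ cong (1ℚ +_) (fromℕ∣S∣≡Σ∈S1 S) ⟩
  1ℚ + Σ∈ S (λ _ → 1ℚ)       ≡⟨ Σᶠ-suc (restrict (inside ∷ S) (λ _ → 1ℚ)) ⟨
  Σ∈ (inside ∷ S) (λ _ → 1ℚ) ∎
  where open ≡-Reasoning
fromℕ∣S∣≡Σ∈S1 (outside ∷ S) = begin
  fromℕ ∣ S ∣                 ≡⟨ fromℕ∣S∣≡Σ∈S1 S ⟩
  Σ∈ S (λ _ → 1ℚ)             ≡⟨ ℚ.+-identityˡ _ ⟨
  0ℚ + Σ∈ S (λ _ → 1ℚ)        ≡⟨ Σᶠ-suc (restrict (outside ∷ S) (λ _ → 1ℚ)) ⟨
  Σ∈ (outside ∷ S) (λ _ → 1ℚ) ∎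
  where open ≡-Reasoning

Σₗ-mono-≤ : (L : List (Fin n)) {f g : Fin n → ℚ} → (∀ {k} → k ∈ₗ L → f k ≤ g k) → Σₗ L f ≤ Σₗ L g
Σₗ-mono-≤ []      f≤g = ℚ.≤-refl
Σₗ-mono-≤ (x ∷ L) f≤g = ℚ.+-mono-≤ (f≤g (here refl)) (Σₗ-mono-≤ L (f≤g ∘ there))

Σₗ-∷ʳ : (L : List (Fin n)) (x : Fin n) (f : Fin n → ℚ) → Σₗ (L ∷ʳ x) f ≡ f x + Σₗ L f
Σₗ-∷ʳ []      x f = refl
Σₗ-∷ʳ (y ∷ L) x f = trans (cong (f y +_) (Σₗ-∷ʳ L x f)) (x∙yz≈y∙xz (f y) (f x) (Σₗ L f))

Σₗ-except : ∀ {c : Fin n} {L} (f : Fin n → ℚ) → All (c ≢_) L → Σₗ L (except c f) ≡ Σₗ L f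
Σₗ-except f []            = refl
Σₗ-except f (c≢x ∷ c∉L) = cong₂ _+_ (except-≢ f (c≢x ∘ sym)) (Σₗ-except f c∉L)

Σₗ-≤-Σᶠ : ∀ {L : List (Fin n)} {f} → Unique L → (∀ i → 0ℚ ≤ f i) → Σₗ L f ≤ Σᶠ f
Σₗ-≤-Σᶠ []                       f≥0 = Σᶠ-nonneg f≥0
Σₗ-≤-Σᶠ {L = x ∷ L} {f} (x∉L ∷ L!) f≥0 = begin
  f x + Σₗ L f               ≡⟨ cong (f x +_) (Σₗ-except f x∉L) ⟨
  f x + Σₗ L (except x f)    ≤⟨ ℚ.+-monoʳ-≤ (f x) (Σₗ-≤-Σᶠ L! (except-nonneg (λ i _ → f≥0 i))) ⟩
  f x + Σᶠ (except x f)      ≡⟨ Σᶠ-except f x ⟨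
  Σᶠ f                       ∎
  where open ℚ.≤-Reasoning

Σₗ-≤-Σ≢ : ∀ {c : Fin n} {L f} → All (c ≢_) L → Unique L → (∀ i → i ≢ c → 0ℚ ≤ f i) → Σₗ L f ≤ Σ≢ c f
Σₗ-≤-Σ≢ {f = f} c∉L L! f≥0 = subst (_≤ _) (Σₗ-except f c∉L) (Σₗ-≤-Σᶠ L! (except-nonneg f≥0))

vertices-∷ : ∀ {E : Fin n → Fin n → Set} {i k j} (e : E i k) (w : Walk E k j) →
             vertices (e ∷ w) ≡ i ∷ (inner (e ∷ w) ∷ʳ j)
vertices-∷ e [ _ ]               = refl
vertices-∷ {i = i} e (e′ ∷ w)   = cong (i ∷_) (vertices-∷ e′ w)

Σ-along-path-≤-Σ≢ : ∀ {E : Fin n → Fin n → Set} {c r} (w : Walk E c r) → IsPath w → c ≢ r →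
                    {f : Fin n → ℚ} → (∀ i → i ≢ c → 0ℚ ≤ f i) → f r + Σₗ (inner w) f ≤ Σ≢ c f
Σ-along-path-≤-Σ≢ [ _ ]   _    c≢r f≥0 = ⊥-elim (c≢r refl)
Σ-along-path-≤-Σ≢ (e ∷ w) path c≢r {f} f≥0 with subst Unique (vertices-∷ e w) path
... | c∉rest ∷ rest! = subst (_≤ _) (Σₗ-∷ʳ (inner (e ∷ w)) _ f) (Σₗ-≤-Σ≢ c∉rest rest! f≥0)

module _ {E : Fin n → Fin n → Set} {U : IsTree E} {D : Fin n → ℚ} {X : Fin n → Fin n → ℚ}
         {Z : Fin n → Fin n → Fin n → ℚ} (F : Feasible U D X Z) where
  open Feasible F

  D-nonneg : ∀ i → 0ℚ ≤ D i
  D-nonneg i = ℚ.≤-trans (Σᶠ-nonneg (except-nonneg (λ j j≢i → X≥0 j i j≢i))) (D≥ i)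

  1≤X+D : ∀ {j r} → j ≢ r → 1ℚ ≤ X j r + D j
  1≤X+D {j} {r} j≢r with IsTree.connected U j r
  ... | w , path = begin
    1ℚ                                              ≤⟨ cover w path j≢r ⟩
    X j r + X r j + Σₗ (inner w) (λ k → Z k j r)   ≤⟨ ℚ.+-monoʳ-≤ (X j r + X r j) Z≤X ⟩
    X j r + X r j + Σₗ (inner w) (λ k → X k j)     ≡⟨ ℚ.+-assoc (X j r) (X r j) _ ⟩
    X j r + (X r j + Σₗ (inner w) (λ k → X k j))   ≤⟨ ℚ.+-monoʳ-≤ (X j r) path≤Σ≢ ⟩
    X j r + Σ≢ j (λ k → X k j)                      ≤⟨ ℚ.+-monoʳ-≤ (X j r) (D≥ j) ⟩
    X j r + D j                                     ∎
    where
    open ℚ.≤-Reasoning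
    Z≤X : Σₗ (inner w) (λ k → Z k j r) ≤ Σₗ (inner w) (λ k → X k j)
    Z≤X = Σₗ-mono-≤ (inner w) (Z≤Xi w path j≢r)
    path≤Σ≢ : X r j + Σₗ (inner w) (λ k → X k j) ≤ Σ≢ j (λ k → X k j)
    path≤Σ≢ = Σ-along-path-≤-Σ≢ w path j≢r (λ i i≢j → X≥0 i j i≢j)

  ∣S∣≤1+Σ∈SD : ∀ {S : Subset n} {r} → r ∈ S → fromℕ ∣ S ∣ ≤ 1ℚ + Σ∈ S D
  ∣S∣≤1+Σ∈SD {S} {r} r∈S = begin
    fromℕ ∣ S ∣                                   ≡⟨ fromℕ∣S∣≡Σ∈S1 S ⟩
    Σ∈ S (λ _ → 1ℚ)                               ≡⟨ Σ∈-remove (λ _ → 1ℚ) r∈S ⟩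
    1ℚ + Σᶠ (except r (restrict S (λ _ → 1ℚ)))    ≤⟨ ℚ.+-monoʳ-≤ 1ℚ (Σᶠ-mono-≤ charge) ⟩
    1ℚ + Σᶠ (λ j → Xr j + D∖r j)                  ≡⟨ cong (1ℚ +_) (Σᶠ-distrib-+ Xr D∖r) ⟩
    1ℚ + (Σ≢ r (λ j → X j r) + Σᶠ D∖r)            ≤⟨ ℚ.+-monoʳ-≤ 1ℚ (ℚ.+-monoˡ-≤ (Σᶠ D∖r) (D≥ r)) ⟩
    1ℚ + (D r + Σᶠ D∖r)                           ≡⟨ cong (1ℚ +_) (Σ∈-remove D r∈S) ⟨
    1ℚ + Σ∈ S D                                   ∎
    where
    open ℚ.≤-Reasoning
    Xr D∖r : Fin n → ℚ
    Xr  = except r (λ j → X j r)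
    D∖r = except r (restrict S D)
    charge : ∀ j → except r (restrict S (λ _ → 1ℚ)) j ≤ Xr j + D∖r j
    charge j with j ≟ r | j ∈? S
    ... | yes _  | _     = ℚ.≤-refl
    ... | no j≢r | yes _ = 1≤X+D j≢r
    ... | no j≢r | no _  = ℚ.≤-trans (X≥0 j r j≢r) (ℚ.≤-reflexive (sym (ℚ.+-identityʳ (X j r))))

lemma3p1 : (n : ℕ) (E : Fin n → Fin n → Set) (U : IsTree E)
    (D : Fin n → ℚ) (X : Fin n → Fin n → ℚ) (Z : Fin n → Fin n → Fin n → ℚ) →
    Feasible U D X Z →
    (S : Subset n) → fromℕ ∣ S ∣ - 1ℚ ≤ Σ∈ S D
lemma3p1 n E U D X Z F S with nonempty? S
... | yes (r , r∈S) = begin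
  fromℕ ∣ S ∣ - 1ℚ             ≤⟨ ℚ.+-monoˡ-≤ (- 1ℚ) (∣S∣≤1+Σ∈SD F r∈S) ⟩
  1ℚ + Σ∈ S D - 1ℚ             ≡⟨ xyx⁻¹≈y 1ℚ (Σ∈ S D) ⟩
  Σ∈ S D                       ∎
  where open ℚ.≤-Reasoning
... | no S-empty rewrite Empty-unique S-empty | ∣⊥∣≡0 n =
  ℚ.≤-trans (*≤* ℤ.-≤+) (Σ∈-nonneg (D-nonneg F))
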